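{- Let $k\geq 2$, $J\geq 0$, $j\geq J+1$ and $i,l\in\{1,\dots,k\}$, and let ${}^J_ih^{(j)}_l(q)$ be as in the context. Then ${}^J_ih^{(j)}_l(q)=\sum_{\lambda}q^{|\lambda|}$, the sum over all partitions $\lambda=(b_1,\dots,b_s)$ with $b_1\geq b_2\geq\cdots\geq b_s$ (of size $|\lambda|=b_1+\cdots+b_s$) satisfying: (1) no odd part is repeated; (2) $b_p-b_{p+k-1}\geq 2$ whenever $p+k-1\leq s$ and $b_p$ is odd; (3) $b_p-b_{p+k-1}>2$ whenever $p+k-1\leq s$ and $b_p$ is even; (4) the smallest part satisfies $b_s>2J$; (5) at most $k-i$ parts are equal to $2J+1$ or $2J+2$; (6) $b_1\leq 2j$ and exactly $l-1$ parts are equal to $2j$.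
   Context: $q$ is a formal variable. Fix $k\geq 2$. For each $j\geq 1$ let $\mathbf{A}'_{(j)}$ be the $k\times k$ matrix with $(r,c)$ entry $[c\leq k-r+1]\,q^{2j(c-1)}+[c\leq k-r]\,q^{2jc-1}$ ($[P]$ is $1$ if $P$ holds, $0$ otherwise). For an integer $J\geq 0$ let ${}^J\mathbf{h}^{(J)}$ be the identity matrix and ${}^J\mathbf{h}^{(j)}=\mathbf{A}'_{(J+1)}\cdots\mathbf{A}'_{(j)}$ for $j>J$; let ${}^J_ih^{(j)}_l(q)$ denote its $(i,l)$ entry. The empty partition is allowed (with size $0$). -}

module Defs where

open import Data.Nat using (ℕ; zero; suc; _+_; _*_; _∸_; _≤_; _<_; _≤ᵇ_; _≡ᵇ_; _%_)
open import Data.Bool using (Bool; true; false; if_then_else_; _∨_)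
open import Data.Fin using (Fin; toℕ) renaming (zero to fzero; suc to fsuc)
open import Data.Fin.Properties using () renaming (_≟_ to _≟ᶠ_)
open import Data.List using (List; []; _∷_; _++_; [_]; replicate; map; foldr; length; head; last)
open import Data.Nat.ListAction using (sum)
open import Data.List.Relation.Unary.All using (All)
open import Data.List.Relation.Unary.Linked using (Linked)
open import Data.Maybe using (just)
open import Data.Product using (_×_)
open import Relation.Binary.PropositionalEquality using (_≡_; _≢_)
open import Relation.Nullary using (¬_)
open import Relation.Nullary.Decidable using (⌊_⌋)

-- Polynomials in q with natural-number coefficients, as coefficient lists
-- (entry at position n is the coefficient of q^n; trailing zeros allowed).

Poly : Set
Poly = List ℕ

infixl 6 _⊕_
infixl 7 _⊗_

_⊕_ : Poly → Poly → Poly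
[]      ⊕ g       = g
(a ∷ f) ⊕ []      = a ∷ f
(a ∷ f) ⊕ (b ∷ g) = (a + b) ∷ (f ⊕ g)

scale : ℕ → Poly → Poly
scale a = map (a *_)

_⊗_ : Poly → Poly → Poly
[]      ⊗ g = []
(a ∷ f) ⊗ g = scale a g ⊕ (0 ∷ (f ⊗ g))

coeff : Poly → ℕ → ℕ
coeff []      n       = 0
coeff (a ∷ f) zero    = a
coeff (a ∷ f) (suc n) = coeff f n

qpow : ℕ → Poly
qpow m = replicate m 0 ++ [ 1 ]

Mat : ℕ → Set
Mat k = Fin k → Fin k → Poly

sumFin : ∀ {n} → (Fin n → Poly) → Poly
sumFin {zero}  f = []
sumFin {suc n} f = f fzero ⊕ sumFin (λ t → f (fsuc t))

_·_ : ∀ {k} → Mat k → Mat k → Mat k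
(M · N) r c = sumFin (λ t → M r t ⊗ N t c)

idMat : ∀ {k} → Mat k
idMat r c = if ⌊ r ≟ᶠ c ⌋ then qpow 0 else []

-- A'_(j): with 1-based r = toℕ r' + 1, c = toℕ c' + 1, the entry is
--   [c ≤ k-r+1] q^(2j(c-1)) + [c ≤ k-r] q^(2jc-1)
A' : (k j : ℕ) → Mat k
A' k j r c =
  (if suc (toℕ c) ≤ᵇ k ∸ toℕ r then qpow (2 * j * toℕ c) else [])
  ⊕ (if suc (toℕ c) ≤ᵇ k ∸ suc (toℕ r) then qpow (2 * j * suc (toℕ c) ∸ 1) else [])

-- ^J h^(j) : identity for j ≤ J (in particular for j = J),
-- and A'_(J+1) ⋯ A'_(j) for j > J.
hMat : (k J j : ℕ) → Mat k
hMat k J zero    = idMat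
hMat k J (suc j) = if J ≤ᵇ j then (hMat k J j · A' k (suc j)) else idMat

-- Partitions as weakly decreasing lists of positive integers b₁ ≥ … ≥ b_s.
-- part b p is b_{p+1} (0-based index; default 0 outside range).

part : List ℕ → ℕ → ℕ
part []      p       = 0
part (x ∷ b) zero    = x
part (x ∷ b) (suc p) = part b p

IsPartition : List ℕ → Set
IsPartition b = Linked (λ x y → y ≤ x) b × All (0 <_) b

Odd Even : ℕ → Set
Odd n  = n % 2 ≡ 1
Even n = n % 2 ≡ 0

countIf : (ℕ → Bool) → List ℕ → ℕ
countIf t []      = 0
countIf t (x ∷ b) = if t x then suc (countIf t b) else countIf t b

-- Conditions (1)–(6) of the proposition, with i, l given 0-based
-- (so the paper's i is toℕ i + 1 and l is toℕ l + 1). Indices p are 0-based,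
-- so "p + k - 1 ≤ s" (1-based p) becomes "p + (k ∸ 1) < s".
record Valid (k J j : ℕ) (i l : Fin k) (b : List ℕ) : Set where
  field
    partition : IsPartition b
    cond1 : ∀ p p′ → p < length b → p′ < length b → p ≢ p′ →
            part b p ≡ part b p′ → ¬ Odd (part b p)
    cond2 : ∀ p → p + (k ∸ 1) < length b → Odd (part b p) →
            part b (p + (k ∸ 1)) + 2 ≤ part b p
    cond3 : ∀ p → p + (k ∸ 1) < length b → Even (part b p) →
            part b (p + (k ∸ 1)) + 2 < part b p
    cond4 : ∀ x → last b ≡ just x → 2 * J < x
    cond5 : countIf (λ x → (x ≡ᵇ 2 * J + 1) ∨ (x ≡ᵇ 2 * J + 2)) b ≤ k ∸ suc (toℕ i)
    cond6a : ∀ x → head b ≡ just x → x ≤ 2 * j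
    cond6b : countIf (λ x → x ≡ᵇ 2 * j) b ≡ toℕ l

genSum : List (List ℕ) → Poly
genSum = foldr (λ b acc → qpow (sum b) ⊕ acc) []

module Submission where

-- Write j = J + n + 1 and k = w + 1.  Mirroring the matrix product we define
-- lists  rowList n t  of partitions: rowList 0 t is [[]] for t = i and empty
-- otherwise, and a partition of rowList (n+1) l is one of rowList n t with a
-- "top block" of level a = n + J prepended: l copies of 2a+2, followed by
-- one 2a+1 for the second kind of block.  The two kinds correspond to the two
-- monomials of the entry (t,l) of A'_(a+1), and a block has exactly the size
-- given by the exponent of its monomial.  Three facts then give the theorem:
--  * generating function: coefficientwise, entry (i,l) of the product equals
--    Σ_{λ ∈ rowList n l} q^|λ|  (rowList-genSum), by polynomial algebra;
--  * characterisation: rowList (n+1) l is exactly the set of partitions with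
--    (1)–(6) (rowList-valid).  The heart of it are the window lemmas: a top
--    block of length m in front of a partition whose largest part 2a occurs
--    c times keeps the gap conditions (2),(3) iff m + c ≤ k - 1, which is
--    precisely when the monomial is present in A'.  At level one the row
--    index i takes the place of c, through condition (5);
--  * no repetitions: the top block, the rest and the column are determined
--    by the partition (rowList-unique).
-- The argument only needs k ≥ 1.


open import Defs
open import Data.Nat using (ℕ; zero; suc; _+_; _*_; _∸_; _≤_; _<_; _≤ᵇ_; _≡ᵇ_; z≤n; s≤s; _≤?_; _<?_; _%_; _≟_)
open import Data.Nat.Properties
open import Data.Nat.Tactic.RingSolver using (solve-∀)
open import Data.Nat.ListAction using (sum)
open import Data.Nat.ListAction.Properties using (sum-++)
open import Data.Bool using (Bool; true; false; if_then_else_; T; _∨_)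
open import Data.Bool.Properties using (T-≡; T-∨)
open import Data.Nat.DivMod using ([m+kn]%n≡m%n)
open import Data.List using (List; []; _∷_; _++_; replicate; map; length; head; last)
open import Data.List.Properties using (length-++; length-replicate; ++-assoc; ++-cancelˡ; ∷-injectiveʳ)
open import Data.List.Relation.Unary.All as All using (All; []; _∷_)
import Data.List.Relation.Unary.All.Properties as AllP
open import Data.List.Relation.Unary.Linked as Linked using (Linked; []; [-]; _∷_)
open import Data.List.Membership.Propositional using (_∈_)
open import Data.List.Membership.Propositional.Properties using (∈-++⁺ˡ; ∈-++⁺ʳ; ∈-++⁻; ∈-map⁺; ∈-map⁻)
open import Data.List.Relation.Unary.Any using (here)
open import Data.List.Relation.Unary.Unique.Propositional using (Unique; []; _∷_)
import Data.List.Relation.Unary.Unique.Propositional.Properties as Unique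
open import Data.Maybe using (just)
open import Data.Product using (Σ; ∃; _×_; _,_; proj₁; proj₂)
open import Data.Sum using (_⊎_; inj₁; inj₂)
open import Data.Unit using (⊤; tt)
open import Relation.Nullary using (¬_; yes; no)
open import Data.Fin using (Fin; toℕ; fromℕ<) renaming (zero to fzero; suc to fsuc)
open import Data.Fin.Properties using (toℕ-injective; toℕ<n; toℕ-fromℕ<) renaming (_≟_ to _≟ᶠ_; suc-injective to fsuc-injective)
open import Relation.Nullary.Decidable using (⌊_⌋)
open import Data.Empty using (⊥; ⊥-elim)
open import Function using (id)
open import Function.Bundles using (Equivalence; _⇔_; mk⇔)
open import Relation.Binary.PropositionalEquality

_≈_ : Poly → Poly → Set
f ≈ g = ∀ n → coeff f n ≡ coeff g n

coeff-⊕ : ∀ f g n → coeff (f ⊕ g) n ≡ coeff f n + coeff g n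
coeff-⊕ []      g       n       = refl
coeff-⊕ (a ∷ f) []      n       = sym (+-identityʳ _)
coeff-⊕ (a ∷ f) (b ∷ g) zero    = refl
coeff-⊕ (a ∷ f) (b ∷ g) (suc n) = coeff-⊕ f g n

coeff-scale : ∀ a g n → coeff (scale a g) n ≡ a * coeff g n
coeff-scale a []      n       = sym (*-zeroʳ a)
coeff-scale a (x ∷ g) zero    = refl
coeff-scale a (x ∷ g) (suc n) = coeff-scale a g n

coeff-∷⊗ : ∀ a f g n → coeff ((a ∷ f) ⊗ g) n ≡ a * coeff g n + coeff (0 ∷ (f ⊗ g)) n
coeff-∷⊗ a f g n = trans (coeff-⊕ (scale a g) _ n) (cong (_+ _) (coeff-scale a g n))

0∷-cong : ∀ {f g} → f ≈ g → (0 ∷ f) ≈ (0 ∷ g)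
0∷-cong f≈g zero    = refl
0∷-cong f≈g (suc n) = f≈g n

shift : ℕ → Poly → Poly
shift a f = replicate a 0 ++ f

shift-cong : ∀ a {f g} → f ≈ g → shift a f ≈ shift a g
shift-cong zero    f≈g = f≈g
shift-cong (suc a) f≈g = 0∷-cong (shift-cong a f≈g)

shift-+ : ∀ a b f → shift (a + b) f ≡ shift a (shift b f)
shift-+ zero    b f = refl
shift-+ (suc a) b f = cong (0 ∷_) (shift-+ a b f)

coeff-shift-[] : ∀ a n → coeff (shift a []) n ≡ 0
coeff-shift-[] zero    n       = refl
coeff-shift-[] (suc a) zero    = refl
coeff-shift-[] (suc a) (suc n) = coeff-shift-[] a n

coeff-shift-⊕ : ∀ a f g n → coeff (shift a (f ⊕ g)) n ≡ coeff (shift a f) n + coeff (shift a g) n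
coeff-shift-⊕ zero    f g n       = coeff-⊕ f g n
coeff-shift-⊕ (suc a) f g zero    = refl
coeff-shift-⊕ (suc a) f g (suc n) = coeff-shift-⊕ a f g n

coeff-shift-∷ : ∀ a x f n → coeff (shift a (x ∷ f)) n ≡ x * coeff (qpow a) n + coeff (shift (suc a) f) n
coeff-shift-∷ zero    x f zero    = sym (trans (+-identityʳ _) (*-identityʳ x))
coeff-shift-∷ zero    x f (suc n) = sym (cong (_+ coeff f n) (*-zeroʳ x))
coeff-shift-∷ (suc a) x f zero    = sym (trans (+-identityʳ _) (*-zeroʳ x))
coeff-shift-∷ (suc a) x f (suc n) = coeff-shift-∷ a x f n

⊗-qpow : ∀ f a → (f ⊗ qpow a) ≈ shift a f
⊗-qpow []      a n = sym (coeff-shift-[] a n)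
⊗-qpow (x ∷ f) a n = begin
  coeff ((x ∷ f) ⊗ qpow a) n                          ≡⟨ coeff-∷⊗ x f (qpow a) n ⟩
  x * coeff (qpow a) n + coeff (0 ∷ (f ⊗ qpow a)) n  ≡⟨ cong (x * coeff (qpow a) n +_) (0∷-cong (⊗-qpow f a) n) ⟩
  x * coeff (qpow a) n + coeff (shift (suc a) f) n    ≡⟨ coeff-shift-∷ a x f n ⟨
  coeff (shift a (x ∷ f)) n                           ∎
  where open ≡-Reasoning

⊗-zeroʳ : ∀ f → (f ⊗ []) ≈ []
⊗-zeroʳ []      n       = refl
⊗-zeroʳ (x ∷ f) zero    = trans (coeff-∷⊗ x f [] zero) (trans (+-identityʳ _) (*-zeroʳ x))
⊗-zeroʳ (x ∷ f) (suc n) = trans (coeff-∷⊗ x f [] (suc n)) (cong₂ _+_ (*-zeroʳ x) (⊗-zeroʳ f n))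

⊗-distribˡ-⊕ : ∀ f g h n → coeff (f ⊗ (g ⊕ h)) n ≡ coeff (f ⊗ g) n + coeff (f ⊗ h) n
⊗-distribˡ-⊕ []      g h n = refl
⊗-distribˡ-⊕ (x ∷ f) g h n = begin
  coeff ((x ∷ f) ⊗ (g ⊕ h)) n
    ≡⟨ coeff-∷⊗ x f (g ⊕ h) n ⟩
  x * coeff (g ⊕ h) n + coeff (0 ∷ (f ⊗ (g ⊕ h))) n
    ≡⟨ cong₂ _+_ (cong (x *_) (coeff-⊕ g h n)) (tail n) ⟩
  x * (coeff g n + coeff h n) + (coeff (0 ∷ (f ⊗ g)) n + coeff (0 ∷ (f ⊗ h)) n)
    ≡⟨ interchange x (coeff g n) (coeff h n) _ _ ⟩
  (x * coeff g n + coeff (0 ∷ (f ⊗ g)) n) + (x * coeff h n + coeff (0 ∷ (f ⊗ h)) n)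
    ≡⟨ cong₂ _+_ (coeff-∷⊗ x f g n) (coeff-∷⊗ x f h n) ⟨
  coeff ((x ∷ f) ⊗ g) n + coeff ((x ∷ f) ⊗ h) n
    ∎
  where
  open ≡-Reasoning
  tail : ∀ n → coeff (0 ∷ (f ⊗ (g ⊕ h))) n ≡ coeff (0 ∷ (f ⊗ g)) n + coeff (0 ∷ (f ⊗ h)) n
  tail zero    = refl
  tail (suc n) = ⊗-distribˡ-⊕ f g h n
  interchange : ∀ x g h u v → x * (g + h) + (u + v) ≡ (x * g + u) + (x * h + v)
  interchange = solve-∀

genSum-++ : ∀ L M n → coeff (genSum (L ++ M)) n ≡ coeff (genSum L) n + coeff (genSum M) n
genSum-++ []      M n = refl
genSum-++ (b ∷ L) M n = begin
  coeff (qpow (sum b) ⊕ genSum (L ++ M)) n                            ≡⟨ coeff-⊕ (qpow (sum b)) _ n ⟩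
  coeff (qpow (sum b)) n + coeff (genSum (L ++ M)) n                  ≡⟨ cong (coeff (qpow (sum b)) n +_) (genSum-++ L M n) ⟩
  coeff (qpow (sum b)) n + (coeff (genSum L) n + coeff (genSum M) n)  ≡⟨ +-assoc (coeff (qpow (sum b)) n) _ _ ⟨
  coeff (qpow (sum b)) n + coeff (genSum L) n + coeff (genSum M) n    ≡⟨ cong (_+ coeff (genSum M) n) (coeff-⊕ (qpow (sum b)) _ n) ⟨
  coeff (genSum (b ∷ L)) n + coeff (genSum M) n                       ∎
  where open ≡-Reasoning

genSum-map : ∀ (g : List ℕ → List ℕ) s → (∀ b → sum (g b) ≡ s + sum b) →
             ∀ L → genSum (map g L) ≈ shift s (genSum L)
genSum-map g s size-g []      n = sym (coeff-shift-[] s n)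
genSum-map g s size-g (b ∷ L) n = begin
  coeff (qpow (sum (g b)) ⊕ genSum (map g L)) n                  ≡⟨ coeff-⊕ (qpow (sum (g b))) _ n ⟩
  coeff (qpow (sum (g b))) n + coeff (genSum (map g L)) n        ≡⟨ cong₂ _+_ (cong (λ m → coeff (qpow m) n) (size-g b))
                                                                                (genSum-map g s size-g L n) ⟩
  coeff (qpow (s + sum b)) n + coeff (shift s (genSum L)) n      ≡⟨ cong (λ p → coeff p n + _) (shift-+ s (sum b) (1 ∷ [])) ⟩
  coeff (shift s (qpow (sum b))) n + coeff (shift s (genSum L)) n ≡⟨ coeff-shift-⊕ s (qpow (sum b)) (genSum L) n ⟨
  coeff (shift s (genSum (b ∷ L))) n                             ∎
  where open ≡-Reasoning

⊗-optionalMonomial : ∀ (c : Bool) s (g : List ℕ → List ℕ) H L → (∀ b → sum (g b) ≡ s + sum b) →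
                     H ≈ genSum L → (H ⊗ (if c then qpow s else [])) ≈ genSum (if c then map g L else [])
⊗-optionalMonomial false s g H L size-g H≈L n = ⊗-zeroʳ H n
⊗-optionalMonomial true  s g H L size-g H≈L n =
  trans (⊗-qpow H s n) (trans (shift-cong s H≈L n) (sym (genSum-map g s size-g L n)))

concatFin : ∀ {A : Set} {m} → (Fin m → List A) → List A
concatFin {m = zero}  F = []
concatFin {m = suc m} F = F fzero ++ concatFin (λ t → F (fsuc t))

sumFin-genSum : ∀ {m} (P : Fin m → Poly) (F : Fin m → List (List ℕ)) →
                (∀ t → P t ≈ genSum (F t)) → sumFin P ≈ genSum (concatFin F)
sumFin-genSum {zero}  P F P≈F n = refl
sumFin-genSum {suc m} P F P≈F n = begin
  coeff (P fzero ⊕ sumFin (λ t → P (fsuc t))) n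
    ≡⟨ coeff-⊕ (P fzero) _ n ⟩
  coeff (P fzero) n + coeff (sumFin (λ t → P (fsuc t))) n
    ≡⟨ cong₂ _+_ (P≈F fzero n) (sumFin-genSum (λ t → P (fsuc t)) (λ t → F (fsuc t)) (λ t → P≈F (fsuc t)) n) ⟩
  coeff (genSum (F fzero)) n + coeff (genSum (concatFin (λ t → F (fsuc t)))) n
    ≡⟨ genSum-++ (F fzero) _ n ⟨
  coeff (genSum (concatFin F)) n
    ∎
  where open ≡-Reasoning

hMat-diagonal : ∀ k J → hMat k J J ≡ idMat
hMat-diagonal k zero    = refl
hMat-diagonal k (suc J) with suc J ≤ᵇ J | ≤ᵇ⇒≤ (suc J) J
... | false | _     = refl
... | true  | sound = ⊥-elim (<-irrefl refl (sound _))

hMat-step : ∀ k J n → hMat k J (suc n + J) ≡ (hMat k J (n + J) · A' k (suc n + J))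
hMat-step k J n rewrite Equivalence.to T-≡ (≤⇒≤ᵇ (m≤n+m J n)) = refl

-- Top blocks.  At level a (corresponding to the factor A'_(a+1)) the two
-- largest parts allowed are 2a+2 and 2a+1; a top block consists of l copies
-- of 2a+2, followed by one 2a+1 when e = true.

evenTop oddTop : ℕ → ℕ
evenTop a = suc (suc (2 * a))
oddTop  a = suc (2 * a)

evenTop≡2*suc : ∀ a → evenTop a ≡ 2 * suc a
evenTop≡2*suc a = sym (*-suc 2 a)

oddPart : Bool → ℕ → List ℕ
oddPart false a = []
oddPart true  a = oddTop a ∷ []

topBlock : Bool → ℕ → ℕ → List ℕ
topBlock e a l = replicate l (evenTop a) ++ oddPart e a

blockLength : Bool → ℕ → ℕ
blockLength false l = l
blockLength true  l = suc l

length-topBlock : ∀ e a l → length (topBlock e a l) ≡ blockLength e l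
length-topBlock false a l = trans (length-++ (replicate l (evenTop a))) (trans (+-identityʳ _) (length-replicate l))
length-topBlock true  a l = trans (length-++ (replicate l (evenTop a)))
                                  (trans (cong (_+ 1) (length-replicate l)) (+-comm l 1))

-- The exponents of the two monomials in column l of A'_(a+1).
blockDegree : Bool → ℕ → ℕ → ℕ
blockDegree false a l = 2 * suc a * l
blockDegree true  a l = 2 * suc a * suc l ∸ 1

sum-replicate : ∀ l v → sum (replicate l v) ≡ l * v
sum-replicate zero    v = refl
sum-replicate (suc l) v = cong (v +_) (sum-replicate l v)

sum-topBlock : ∀ e a l → sum (topBlock e a l) ≡ blockDegree e a l
sum-topBlock e a l = begin
  sum (replicate l (evenTop a) ++ oddPart e a)       ≡⟨ sum-++ (replicate l (evenTop a)) (oddPart e a) ⟩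
  sum (replicate l (evenTop a)) + sum (oddPart e a)  ≡⟨ cong (_+ sum (oddPart e a)) (sum-replicate l (evenTop a)) ⟩
  l * evenTop a + sum (oddPart e a)                  ≡⟨ degree e ⟩
  blockDegree e a l                                  ∎
  where
  open ≡-Reasoning
  degree : ∀ e → l * evenTop a + sum (oddPart e a) ≡ blockDegree e a l
  degree false = evenBlock a l
    where
    evenBlock : ∀ a l → l * suc (suc (2 * a)) + 0 ≡ 2 * suc a * l
    evenBlock = solve-∀
  degree true  = cong (_∸ 1) (oddBlock a l)
    where
    oddBlock : ∀ a l → suc (l * suc (suc (2 * a)) + (suc (2 * a) + 0)) ≡ 2 * suc a * suc l
    oddBlock = solve-∀

extend : Bool → ℕ → ℕ → List ℕ → List ℕ
extend e a l b = topBlock e a l ++ b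

extend-split : ∀ e a l b → extend e a l b ≡ replicate l (evenTop a) ++ (oddPart e a ++ b)
extend-split e a l b = ++-assoc (replicate l (evenTop a)) (oddPart e a) b

sum-extend : ∀ e a l b → sum (extend e a l b) ≡ blockDegree e a l + sum b
sum-extend e a l b = trans (sum-++ (topBlock e a l) b) (cong (_+ sum b) (sum-topBlock e a l))

Decreasing : List ℕ → Set
Decreasing = Linked (λ x y → y ≤ x)

decreasing-head : ∀ {x r} → Decreasing (x ∷ r) → All (_≤ x) r
decreasing-head [-]         = []
decreasing-head (y≤x ∷ dec) = y≤x ∷ All.map (λ z≤y → ≤-trans z≤y y≤x) (decreasing-head dec)

decreasing-∷ : ∀ {x r} → All (_≤ x) r → Decreasing r → Decreasing (x ∷ r)
decreasing-∷ []        _   = [-]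
decreasing-∷ (y≤x ∷ _) dec = y≤x ∷ dec

decreasing-++⁻ʳ : ∀ P {b} → Decreasing (P ++ b) → Decreasing b
decreasing-++⁻ʳ []      dec = dec
decreasing-++⁻ʳ (x ∷ P) dec = decreasing-++⁻ʳ P (Linked.tail dec)

decreasing-replicate : ∀ l v {r} → All (_≤ v) r → Decreasing r → Decreasing (replicate l v ++ r)
decreasing-replicate zero    v r≤v dec = dec
decreasing-replicate (suc l) v r≤v dec =
  decreasing-∷ (AllP.++⁺ (AllP.replicate⁺ l ≤-refl) r≤v) (decreasing-replicate l v r≤v dec)

-- Conditions (4) and (6) speak about the last and the first part; for a
-- decreasing list they bound all parts.

last-All : ∀ {P : ℕ → Set} b {x} → All P b → last b ≡ just x → P x
last-All (y ∷ [])    (py ∷ []) refl = py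
last-All (y ∷ z ∷ r) (_ ∷ pr)  eq   = last-All (z ∷ r) pr eq

All-from-last : ∀ {m} b → Decreasing b → (∀ x → last b ≡ just x → m < x) → All (m <_) b
All-from-last []          _           _ = []
All-from-last (x ∷ [])    _           h = h x refl ∷ []
All-from-last (x ∷ y ∷ r) (y≤x ∷ dec) h with All-from-last (y ∷ r) dec h
... | rest@(m<y ∷ _) = <-≤-trans m<y y≤x ∷ rest

head-All : ∀ {P : ℕ → Set} b {x} → All P b → head b ≡ just x → P x
head-All (y ∷ b) (py ∷ _) refl = py

All-from-head : ∀ {m} b → Decreasing b → (∀ x → head b ≡ just x → x ≤ m) → All (_≤ m) b
All-from-head []      _   _ = []
All-from-head (x ∷ r) dec h = h x refl ∷ All.map (λ y≤x → ≤-trans y≤x (h x refl)) (decreasing-head dec)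

part-All : ∀ {P : ℕ → Set} b q → All P b → q < length b → P (part b q)
part-All (x ∷ b) zero    (px ∷ _)  _         = px
part-All (x ∷ b) (suc q) (_ ∷ pb) (s≤s q<) = part-All b q pb q<

All-part : ∀ {P : ℕ → Set} b → (∀ q → q < length b → P (part b q)) → All P b
All-part []      h = []
All-part (x ∷ b) h = h 0 (s≤s z≤n) ∷ All-part b (λ q q< → h (suc q) (s≤s q<))

part-++ˡ : ∀ xs ys q → q < length xs → part (xs ++ ys) q ≡ part xs q
part-++ˡ (x ∷ xs) ys zero    _         = refl
part-++ˡ (x ∷ xs) ys (suc q) (s≤s q<) = part-++ˡ xs ys q q<

part-++ʳ : ∀ xs ys q → length xs ≤ q → part (xs ++ ys) q ≡ part ys (q ∸ length xs)
part-++ʳ []       ys q       _        = refl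
part-++ʳ (x ∷ xs) ys (suc q) (s≤s ≤q) = part-++ʳ xs ys q ≤q

countIf-++ : ∀ f xs ys → countIf f (xs ++ ys) ≡ countIf f xs + countIf f ys
countIf-++ f []       ys = refl
countIf-++ f (x ∷ xs) ys with f x
... | true  = cong suc (countIf-++ f xs ys)
... | false = countIf-++ f xs ys

countIf-all : ∀ f xs → All (λ x → T (f x)) xs → countIf f xs ≡ length xs
countIf-all f []       _          = refl
countIf-all f (x ∷ xs) (fx ∷ fxs) with f x
... | true  = cong suc (countIf-all f xs fxs)
... | false = ⊥-elim fx

countIf-none : ∀ f xs → All (λ x → ¬ T (f x)) xs → countIf f xs ≡ 0
countIf-none f []       _          = refl
countIf-none f (x ∷ xs) (fx ∷ fxs) with f x
... | true  = ⊥-elim (fx tt)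
... | false = countIf-none f xs fxs

countIf-≤-length : ∀ f xs → countIf f xs ≤ length xs
countIf-≤-length f []       = z≤n
countIf-≤-length f (x ∷ xs) with f x
... | true  = s≤s (countIf-≤-length f xs)
... | false = m≤n⇒m≤1+n (countIf-≤-length f xs)

countIf-++⁻ʳ : ∀ f P b → countIf f b ≤ countIf f (P ++ b)
countIf-++⁻ʳ f P b = subst (countIf f b ≤_) (sym (countIf-++ f P b)) (m≤n+m _ _)

mult : ℕ → List ℕ → ℕ
mult u = countIf (λ x → x ≡ᵇ u)

mult-absent : ∀ u b → All (_< u) b → mult u b ≡ 0
mult-absent u b b<u = countIf-none _ b (All.map (λ {y} y<u y≡u → <-irrefl (≡ᵇ⇒≡ y u y≡u) y<u) b<u)

mult-replicate : ∀ l u r → mult u (replicate l u ++ r) ≡ l + mult u r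
mult-replicate l u r = trans (countIf-++ _ (replicate l u) r)
  (cong (_+ mult u r) (trans (countIf-all _ (replicate l u) (AllP.replicate⁺ l (≡⇒≡ᵇ u u refl)))
                             (length-replicate l)))

part-in-topRun : ∀ u b q → Decreasing b → All (_≤ u) b → q < mult u b → part b q ≡ u
part-in-topRun u (x ∷ r) q dec (x≤u ∷ r≤u) q< with x ≡ᵇ u | ≡ᵇ⇒≡ x u | ≡⇒≡ᵇ x u
part-in-topRun u (x ∷ r) zero    dec (x≤u ∷ r≤u) q<        | true  | x≡u | _ = x≡u tt
part-in-topRun u (x ∷ r) (suc q) dec (x≤u ∷ r≤u) (s≤s q<) | true  | _   | _ =
  part-in-topRun u r q (Linked.tail dec) r≤u q<
... | false | _ | x≢u = ⊥-elim (n≮0 (subst (q <_) (mult-absent u r r<u) q<))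
  where
  x<u : x < u
  x<u = ≤∧≢⇒< x≤u x≢u
  r<u : All (_< u) r
  r<u = All.map (λ y≤x → ≤-<-trans y≤x x<u) (decreasing-head dec)

part-after-topRun : ∀ u b q → Decreasing b → All (_≤ u) b → mult u b ≤ q → q < length b → part b q < u
part-after-topRun u (x ∷ r) q dec (x≤u ∷ r≤u) ≤q q< with x ≡ᵇ u | ≡⇒≡ᵇ x u
part-after-topRun u (x ∷ r) (suc q) dec (x≤u ∷ r≤u) (s≤s ≤q) (s≤s q<) | true | _ =
  part-after-topRun u r q (Linked.tail dec) r≤u ≤q q<
... | false | x≢u = ≤-<-trans (part-All (x ∷ r) q (≤-refl ∷ decreasing-head dec) q<) (≤∧≢⇒< x≤u x≢u)

topRun : ∀ u b → Decreasing b → All (_≤ u) b →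
         Σ (List ℕ) λ r → (b ≡ replicate (mult u b) u ++ r) × All (_< u) r
topRun u []      _   _ = [] , refl , []
topRun u (x ∷ b) dec (x≤u ∷ b≤u) with x ≡ᵇ u | ≡ᵇ⇒≡ x u | ≡⇒≡ᵇ x u
... | true | x≡u | _ with topRun u b (Linked.tail dec) b≤u
...   | r , b≡ , r<u = r , cong₂ _∷_ (x≡u tt) b≡ , r<u
topRun u (x ∷ b) dec (x≤u ∷ b≤u) | false | _ | x≢u =
  x ∷ b , cong (λ m → replicate m u ++ x ∷ b) (sym (mult-absent u b b<u)) , x<u ∷ b<u
  where
  x<u : x < u
  x<u = ≤∧≢⇒< x≤u x≢u
  b<u : All (_< u) b
  b<u = All.map (λ y≤x → ≤-<-trans y≤x x<u) (decreasing-head dec)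

parity-+2* : ∀ r a → (r + 2 * a) % 2 ≡ r % 2
parity-+2* r a = trans (cong (λ m → (r + m) % 2) (*-comm 2 a)) ([m+kn]%n≡m%n r a 2)

even-2* : ∀ a → Even (2 * a)
even-2* = parity-+2* 0

even-evenTop : ∀ a → Even (evenTop a)
even-evenTop = parity-+2* 2

odd-oddTop : ∀ a → Odd (oddTop a)
odd-oddTop = parity-+2* 1

odd-not-even : ∀ {x} → Odd x → Even x → ⊥
odd-not-even odd even with trans (sym odd) even
... | ()

NoRepeatedOdd : List ℕ → Set
NoRepeatedOdd []      = ⊤
NoRepeatedOdd (x ∷ r) = (Odd x → All (_≢ x) r) × NoRepeatedOdd r

noRepeatedOdd⇒cond1 : ∀ b → NoRepeatedOdd b → ∀ p p′ → p < length b → p′ < length b → p ≢ p′ →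
                      part b p ≡ part b p′ → ¬ Odd (part b p)
noRepeatedOdd⇒cond1 (x ∷ r) nro zero    zero     _ _ p≢p′ _ = ⊥-elim (p≢p′ refl)
noRepeatedOdd⇒cond1 (x ∷ r) nro zero    (suc q)  _ (s≤s q<) _ x≡y odd =
  part-All r q (proj₁ nro odd) q< (sym x≡y)
noRepeatedOdd⇒cond1 (x ∷ r) nro (suc q) zero     (s≤s q<) _ _ y≡x odd =
  part-All r q (proj₁ nro (subst Odd y≡x odd)) q< y≡x
noRepeatedOdd⇒cond1 (x ∷ r) nro (suc q) (suc q′) (s≤s q<) (s≤s q′<) q≢q′ eq =
  noRepeatedOdd⇒cond1 r (proj₂ nro) q q′ q< q′< (λ e → q≢q′ (cong suc e)) eq

cond1⇒noRepeatedOdd : ∀ b → (∀ p p′ → p < length b → p′ < length b → p ≢ p′ →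
                      part b p ≡ part b p′ → ¬ Odd (part b p)) → NoRepeatedOdd b
cond1⇒noRepeatedOdd []      h = tt
cond1⇒noRepeatedOdd (x ∷ r) h =
  (λ odd → All-part r (λ q q< y≡x → h 0 (suc q) (s≤s z≤n) (s≤s q<) (λ ()) (sym y≡x) odd)) ,
  cond1⇒noRepeatedOdd r (λ p p′ p< p′< p≢p′ → h (suc p) (suc p′) (s≤s p<) (s≤s p′<) (λ e → p≢p′ (suc-injective e)))

noRepeatedOdd-++⁻ʳ : ∀ P {b} → NoRepeatedOdd (P ++ b) → NoRepeatedOdd b
noRepeatedOdd-++⁻ʳ []      nro = nro
noRepeatedOdd-++⁻ʳ (x ∷ P) nro = noRepeatedOdd-++⁻ʳ P (proj₂ nro)

-- Conditions (2) and (3): a part x must exceed the part y lying k-1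
-- positions later by  Gap x y;  Window w b  demands this at distance w.

Gap : ℕ → ℕ → Set
Gap x y = (Odd x → y + 2 ≤ x) × (Even x → y + 2 < x)

Window : ℕ → List ℕ → Set
Window w []      = ⊤
Window w (x ∷ r) = (w < length (x ∷ r) → Gap x (part (x ∷ r) w)) × Window w r

window⇒gaps : ∀ w b → Window w b → ∀ p → p + w < length b → Gap (part b p) (part b (p + w))
window⇒gaps w (x ∷ r) win zero    p+w<       = proj₁ win p+w<
window⇒gaps w (x ∷ r) win (suc p) (s≤s p+w<) = window⇒gaps w r (proj₂ win) p p+w<

gaps⇒window : ∀ w b → (∀ p → p + w < length b → Gap (part b p) (part b (p + w))) → Window w b
gaps⇒window w []      h = tt
gaps⇒window w (x ∷ r) h = h 0 , gaps⇒window w r (λ p p+w< → h (suc p) (s≤s p+w<))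

window-++⁻ʳ : ∀ w P {b} → Window w (P ++ b) → Window w b
window-++⁻ʳ w []      win = win
window-++⁻ʳ w (x ∷ P) win = window-++⁻ʳ w P (proj₂ win)

TopValue : ℕ → ℕ → Set
TopValue a x = x ≡ evenTop a ⊎ x ≡ oddTop a

topBlock-top : ∀ e a l → All (TopValue a) (topBlock e a l)
topBlock-top e a l = AllP.++⁺ (AllP.replicate⁺ l (inj₁ refl)) (oddPart-top e)
  where
  oddPart-top : ∀ e → All (TopValue a) (oddPart e a)
  oddPart-top false = []
  oddPart-top true  = inj₂ refl ∷ []

top-above : ∀ {a x} → TopValue a x → 2 * a < x
top-above (inj₁ refl) = n≤1+n _
top-above (inj₂ refl) = ≤-refl

top-≤ : ∀ {a x} → TopValue a x → x ≤ evenTop a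
top-≤ (inj₁ refl) = ≤-refl
top-≤ (inj₂ refl) = n≤1+n _

top-gap : ∀ {a x y} → TopValue a x → y < 2 * a → Gap x y
top-gap {a} {x} {y} top y< = odd-case top , even-case top
  where
  y+2≤ : y + 2 ≤ oddTop a
  y+2≤ = subst (_≤ oddTop a) (sym (+-comm y 2)) (s≤s y<)
  odd-case : TopValue a x → Odd x → y + 2 ≤ x
  odd-case (inj₁ refl) _ = m≤n⇒m≤1+n y+2≤
  odd-case (inj₂ refl) _ = y+2≤
  even-case : TopValue a x → Even x → y + 2 < x
  even-case (inj₁ refl) _    = s≤s y+2≤
  even-case (inj₂ refl) even = ⊥-elim (odd-not-even {oddTop a} (odd-oddTop a) even)

top-no-gap : ∀ {a x y} → TopValue a x → 2 * a ≤ y → ¬ Gap x y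
top-no-gap {a} {y = y} top ≤y (odd-case , even-case) = refute top
  where
  evenTop≤ : evenTop a ≤ y + 2
  evenTop≤ = subst (evenTop a ≤_) (sym (+-comm y 2)) (s≤s (s≤s ≤y))
  refute : TopValue a _ → ⊥
  refute (inj₁ refl) = <⇒≱ (even-case (even-evenTop a)) evenTop≤
  refute (inj₂ refl) = <⇒≱ evenTop≤ (odd-case (odd-oddTop a))

window-mult : ∀ w a b → Decreasing b → All (_≤ 2 * a) b → Window w b → mult (2 * a) b ≤ w
window-mult w a []      _   _  _                 = z≤n
window-mult w a (x ∷ r) dec b≤ (head-window , _) with mult (2 * a) (x ∷ r) ≤? w
... | yes m≤w = m≤w
... | no  m≰w = ⊥-elim (<-irrefl refl (≤-<-trans (m≤m+n (2 * a) 2) (proj₂ self-gap (even-2* a))))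
  where
  w<m : w < mult (2 * a) (x ∷ r)
  w<m = ≰⇒> m≰w
  at : ∀ q → q < mult (2 * a) (x ∷ r) → part (x ∷ r) q ≡ 2 * a
  at q = part-in-topRun (2 * a) (x ∷ r) q dec b≤
  self-gap : Gap (2 * a) (2 * a)
  self-gap = subst₂ Gap (at 0 (≤-<-trans z≤n w<m)) (at w w<m)
               (head-window (<-≤-trans w<m (countIf-≤-length _ (x ∷ r))))

window-prepend : ∀ w a P b → All (TopValue a) P → Decreasing b → All (_≤ 2 * a) b →
                 length P + mult (2 * a) b ≤ w → Window w b → Window w (P ++ b)
window-prepend w a []      b _               dec b≤ fits win = win
window-prepend w a (x ∷ P) b (top-x ∷ top-P) dec b≤ fits win =
  head-gap , window-prepend w a P b top-P dec b≤ (≤-trans (n≤1+n _) fits) win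
  where
  L : ℕ
  L = length (x ∷ P)
  L≤w : L ≤ w
  L≤w = ≤-trans (m≤m+n L _) fits
  -- the part w places after x lies in b, past its run of 2a's
  head-gap : w < length (x ∷ P ++ b) → Gap x (part (x ∷ P ++ b) w)
  head-gap w<len = subst (Gap x) (sym (part-++ʳ (x ∷ P) b w L≤w))
    (top-gap {a} top-x (part-after-topRun (2 * a) b (w ∸ L) dec b≤
      (m+n≤o⇒m≤o∸n (mult (2 * a) b) (subst (_≤ w) (+-comm L _) fits))
      (subst (w ∸ L <_) (m+n∸m≡n L (length b)) (∸-monoˡ-< (subst (w <_) (length-++ (x ∷ P)) w<len) L≤w))))

window-prepend⁻ : ∀ w a P b → All (TopValue a) P → Decreasing b → All (_≤ 2 * a) b →
                  Window w (P ++ b) → length P + mult (2 * a) b ≤ w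
window-prepend⁻ w a []      b _               dec b≤ win = window-mult w a b dec b≤ win
window-prepend⁻ w a (x ∷ P) b (top-x ∷ top-P) dec b≤ (head-window , _) with length (x ∷ P) + mult (2 * a) b ≤? w
... | yes fits = fits
... | no ¬fits = ⊥-elim (top-no-gap {a} top-x 2a≤y (head-window w<len))
  where
  L : ℕ
  L = length (x ∷ P)
  w< : w < L + mult (2 * a) b
  w< = ≰⇒> ¬fits
  w<len : w < length (x ∷ P ++ b)
  w<len = subst (w <_) (sym (length-++ (x ∷ P))) (≤-trans w< (+-monoʳ-≤ L (countIf-≤-length _ b)))
  -- the part w places after x is a top value of P or a copy of 2a in b
  2a≤y : 2 * a ≤ part (x ∷ P ++ b) w
  2a≤y with w <? L
  ... | yes w<L = subst (2 * a ≤_) (sym (part-++ˡ (x ∷ P) b w w<L))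
                    (<⇒≤ (top-above {a} (part-All (x ∷ P) w (top-x ∷ top-P) w<L)))
  ... | no  w≮L = ≤-reflexive (sym (trans (part-++ʳ (x ∷ P) b w (≮⇒≥ w≮L))
                    (part-in-topRun (2 * a) b (w ∸ L) dec b≤
                      (subst (w ∸ L <_) (m+n∸m≡n L _) (∸-monoˡ-< w< (≮⇒≥ w≮L))))))

oddPart-< : ∀ e a {b} → All (_≤ 2 * a) b → All (_< evenTop a) (oddPart e a ++ b)
oddPart-< false a b≤ = All.map (λ y≤ → s≤s (m≤n⇒m≤1+n y≤)) b≤
oddPart-< true  a b≤ = ≤-refl ∷ oddPart-< false a b≤

decreasing-extend : ∀ e a l {b} → All (_≤ 2 * a) b → Decreasing b → Decreasing (extend e a l b)
decreasing-extend e a l {b} b≤ dec =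
  subst Decreasing (sym (extend-split e a l b)) (decreasing-replicate l (evenTop a) (All.map <⇒≤ (oddPart-< e a b≤)) (tail e))
  where
  tail : ∀ e → Decreasing (oddPart e a ++ b)
  tail false = dec
  tail true  = decreasing-∷ (All.map (λ y≤ → m≤n⇒m≤1+n y≤) b≤) dec

noRepeatedOdd-extend : ∀ e a l {b} → All (_≤ 2 * a) b → NoRepeatedOdd b → NoRepeatedOdd (extend e a l b)
noRepeatedOdd-extend e a l {b} b≤ nro =
  subst NoRepeatedOdd (sym (extend-split e a l b)) (evenRun l (tail e))
  where
  -- 2a+2 is even, so its repetitions are harmless
  evenRun : ∀ l {r} → NoRepeatedOdd r → NoRepeatedOdd (replicate l (evenTop a) ++ r)
  evenRun zero    nro = nro
  evenRun (suc l) nro = (λ odd → ⊥-elim (odd-not-even {evenTop a} odd (even-evenTop a))) , evenRun l nro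
  tail : ∀ e → NoRepeatedOdd (oddPart e a ++ b)
  tail false = nro
  tail true  = (λ _ → All.map (λ y≤ y≡ → <-irrefl y≡ (s≤s y≤)) b≤) , nro

mult-extend : ∀ e a l {b} → All (_≤ 2 * a) b → mult (evenTop a) (extend e a l b) ≡ l
mult-extend e a l {b} b≤ = begin
  mult (evenTop a) (extend e a l b)                                     ≡⟨ cong (mult (evenTop a)) (extend-split e a l b) ⟩
  mult (evenTop a) (replicate l (evenTop a) ++ (oddPart e a ++ b))      ≡⟨ mult-replicate l (evenTop a) _ ⟩
  l + mult (evenTop a) (oddPart e a ++ b)                               ≡⟨ cong (l +_) (mult-absent _ _ (oddPart-< e a b≤)) ⟩
  l + 0                                                                 ≡⟨ +-identityʳ l ⟩
  l                                                                     ∎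
  where open ≡-Reasoning

extend-injective : ∀ a e e′ l {b b′} → All (_≤ 2 * a) b → All (_≤ 2 * a) b′ →
                   extend e a l b ≡ extend e′ a l b′ → e ≡ e′ × b ≡ b′
extend-injective a e e′ l {b} {b′} b≤ b′≤ eq =
  tails e e′ b≤ b′≤ (++-cancelˡ (replicate l (evenTop a)) _ _
    (trans (sym (extend-split e a l b)) (trans eq (extend-split e′ a l b′))))
  where
  oddTop≰ : ∀ {r} → All (_≤ 2 * a) (oddTop a ∷ r) → ⊥
  oddTop≰ (≤2a ∷ _) = <-irrefl refl ≤2a
  tails : ∀ e e′ {b b′} → All (_≤ 2 * a) b → All (_≤ 2 * a) b′ →
          oddPart e a ++ b ≡ oddPart e′ a ++ b′ → e ≡ e′ × b ≡ b′
  tails false false _  _   eq   = refl , eq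
  tails true  true  _  _   eq   = refl , ∷-injectiveʳ eq
  tails false true  b≤ _   refl = ⊥-elim (oddTop≰ b≤)
  tails true  false _  b′≤ refl = ⊥-elim (oddTop≰ b′≤)

decompose : ∀ a b → Decreasing b → All (_≤ evenTop a) b → NoRepeatedOdd b →
            Σ Bool λ e → Σ (List ℕ) λ b′ → (b ≡ extend e a (mult (evenTop a) b) b′) × All (_≤ 2 * a) b′
decompose a b dec b≤ nro with topRun (evenTop a) b dec b≤
... | r , b≡ , r< = belowRun r b≡ (decreasing-++⁻ʳ R (subst Decreasing b≡ dec))
                      (noRepeatedOdd-++⁻ʳ R (subst NoRepeatedOdd b≡ nro)) r<
  where
  R : List ℕ
  R = replicate (mult (evenTop a) b) (evenTop a)
  below-oddTop : ∀ {y} → y ≤ oddTop a → y ≢ oddTop a → y ≤ 2 * a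
  below-oddTop y≤ y≢ = ≤-pred (≤∧≢⇒< y≤ y≢)
  belowRun : ∀ r → b ≡ R ++ r → Decreasing r → NoRepeatedOdd r → All (_< evenTop a) r →
             Σ Bool λ e → Σ (List ℕ) λ b′ → (b ≡ extend e a (mult (evenTop a) b) b′) × All (_≤ 2 * a) b′
  belowRun []      b≡ _   _   _          = false , [] , trans b≡ (sym (extend-split false a _ [])) , []
  belowRun (x ∷ r) b≡ dec nro (x< ∷ _) with x ≟ oddTop a
  ... | yes refl = true , r , trans b≡ (sym (extend-split true a _ r)) ,
                   All.zipWith (λ (y≤ , y≢) → below-oddTop y≤ y≢) (decreasing-head dec , proj₁ nro (odd-oddTop a))
  ... | no  x≢   = false , x ∷ r , trans b≡ (sym (extend-split false a _ (x ∷ r))) ,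
                   (x≤ ∷ All.map (λ y≤x → ≤-trans y≤x x≤) (decreasing-head dec))
    where
    x≤ : x ≤ 2 * a
    x≤ = below-oddTop (≤-pred x<) x≢

∈-if : ∀ {A : Set} (c : Bool) {X : List A} {x} → x ∈ (if c then X else []) ⇔ (T c × x ∈ X)
∈-if true  = mk⇔ (tt ,_) proj₂
∈-if false = mk⇔ (λ ()) (λ { (() , _) })

unique-if : ∀ {A : Set} (c : Bool) {X : List A} → Unique X → Unique (if c then X else [])
unique-if true  u = u
unique-if false u = []

∈-concatFin : ∀ {A : Set} {m} (F : Fin m → List A) {x} → x ∈ concatFin F ⇔ Σ (Fin m) (λ t → x ∈ F t)
∈-concatFin {A} F = mk⇔ (to F) (λ (t , x∈) → from F t x∈)
  where
  to : ∀ {m} (F : Fin m → List A) {x} → x ∈ concatFin F → Σ (Fin m) (λ t → x ∈ F t)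
  to {suc m} F x∈ with ∈-++⁻ (F fzero) x∈
  ... | inj₁ x∈₀ = fzero , x∈₀
  ... | inj₂ x∈ₛ with to (λ t → F (fsuc t)) x∈ₛ
  ...   | t , x∈ₜ = fsuc t , x∈ₜ
  from : ∀ {m} (F : Fin m → List A) t {x} → x ∈ F t → x ∈ concatFin F
  from F fzero    x∈ = ∈-++⁺ˡ x∈
  from F (fsuc t) x∈ = ∈-++⁺ʳ (F fzero) (from (λ t → F (fsuc t)) t x∈)

unique-concatFin : ∀ {A : Set} {m} (F : Fin m → List A) → (∀ t → Unique (F t)) →
                   (∀ t t′ {x} → x ∈ F t → x ∈ F t′ → t ≡ t′) → Unique (concatFin F)
unique-concatFin {m = zero}  F uF disjoint = []
unique-concatFin {m = suc m} F uF disjoint =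
  Unique.++⁺ (uF fzero)
    (unique-concatFin (λ t → F (fsuc t)) (λ t → uF (fsuc t)) (λ t t′ x∈ x∈′ → fsuc-injective (disjoint _ _ x∈ x∈′)))
    apart
  where
  apart : ∀ {x} → ¬ (x ∈ F fzero × x ∈ concatFin (λ t → F (fsuc t)))
  apart (x∈₀ , x∈ₛ) with Equivalence.to (∈-concatFin (λ t → F (fsuc t))) x∈ₛ
  ... | t , x∈ₜ with disjoint fzero (fsuc t) x∈₀ x∈ₜ
  ... | ()

module RowExpansion (w J : ℕ) (i : Fin (suc w)) where

  k : ℕ
  k = suc w

  -- Whether the monomial of kind e (false: q^(2j(c-1)), true: q^(2jc-1))
  -- occurs in the entry (t,l) of A'.
  present : Bool → Fin k → Fin k → Bool
  present false t l = suc (toℕ l) ≤ᵇ k ∸ toℕ t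
  present true  t l = suc (toℕ l) ≤ᵇ k ∸ suc (toℕ t)

  -- rowList n t lists the partitions counted by the entry (i,t) of
  -- A'_(J+1) ⋯ A'_(J+n).
  rowList : ℕ → Fin k → List (List ℕ)
  piece : ℕ → Fin k → Fin k → List (List ℕ)
  extensions : Bool → ℕ → Fin k → Fin k → List (List ℕ)
  rowList zero    t = if ⌊ i ≟ᶠ t ⌋ then [] ∷ [] else []
  rowList (suc n) l = concatFin (λ t → piece n t l)
  piece n t l = extensions false n t l ++ extensions true n t l
  extensions e n t l = if present e t l then map (extend e (n + J) (toℕ l)) (rowList n t) else []

  rowList-genSum : ∀ n t → hMat k J (n + J) i t ≈ genSum (rowList n t)
  rowList-genSum zero t m rewrite hMat-diagonal k J with ⌊ i ≟ᶠ t ⌋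
  ... | true  = refl
  ... | false = refl
  rowList-genSum (suc n) l rewrite hMat-step k J n =
    sumFin-genSum (λ t → H t ⊗ A' k (suc a) t l) (λ t → piece n t l) entry
    where
    a : ℕ
    a = n + J
    H : Fin k → Poly
    H t = hMat k J a i t
    -- an entry of A'_(a+1) is the sum of its two optional monomials
    entry : ∀ t → (H t ⊗ A' k (suc a) t l) ≈ genSum (piece n t l)
    entry t m = begin
      coeff (H t ⊗ A' k (suc a) t l) m
        ≡⟨ ⊗-distribˡ-⊕ (H t) _ _ m ⟩
      coeff (H t ⊗ monomial false) m + coeff (H t ⊗ monomial true) m
        ≡⟨ cong₂ _+_ (term false) (term true) ⟩
      coeff (genSum (extensions false n t l)) m + coeff (genSum (extensions true n t l)) m
        ≡⟨ genSum-++ (extensions false n t l) _ m ⟨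
      coeff (genSum (piece n t l)) m
        ∎
      where
      open ≡-Reasoning
      monomial : Bool → Poly
      monomial e = if present e t l then qpow (blockDegree e a (toℕ l)) else []
      term : ∀ e → coeff (H t ⊗ monomial e) m ≡ coeff (genSum (extensions e n t l)) m
      term e = ⊗-optionalMonomial (present e t l) _ (extend e a (toℕ l)) (H t) (rowList n t)
                 (sum-extend e a (toℕ l)) (rowList-genSum n t) m

  low : ℕ → Bool
  low x = (x ≡ᵇ 2 * J + 1) ∨ (x ≡ᵇ 2 * J + 2)

  record Shape (top : ℕ) (b : List ℕ) : Set where
    field
      decreasing    : Decreasing b
      noRepeatedOdd : NoRepeatedOdd b
      window        : Window w b
      above         : All (2 * J <_) b
      below         : All (_≤ top) b

  record Admissible (top c : ℕ) (b : List ℕ) : Set where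
    field
      shape   : Shape top b
      fewLow  : countIf low b ≤ w ∸ toℕ i
      topMult : mult top b ≡ c

  valid⇔admissible : ∀ j l b → Valid k J j i l b ⇔ Admissible (2 * j) (toℕ l) b
  valid⇔admissible j l b = mk⇔ to from
    where
    to : Valid k J j i l b → Admissible (2 * j) (toℕ l) b
    to v = record
      { shape   = record
        { decreasing    = proj₁ partition
        ; noRepeatedOdd = cond1⇒noRepeatedOdd b cond1
        ; window        = gaps⇒window w b (λ p p+w< → cond2 p p+w< , cond3 p p+w<)
        ; above         = All-from-last b (proj₁ partition) cond4
        ; below         = All-from-head b (proj₁ partition) cond6a }
      ; fewLow  = cond5
      ; topMult = cond6b }
      where open Valid v
    from : Admissible (2 * j) (toℕ l) b → Valid k J j i l b
    from adm = record
      { partition = decreasing , All.map (≤-<-trans z≤n) above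
      ; cond1     = noRepeatedOdd⇒cond1 b noRepeatedOdd
      ; cond2     = λ p p+w< → proj₁ (window⇒gaps w b window p p+w<)
      ; cond3     = λ p p+w< → proj₂ (window⇒gaps w b window p p+w<)
      ; cond4     = λ x → last-All b above
      ; cond5     = fewLow
      ; cond6a    = λ x → head-All b below
      ; cond6b    = topMult }
      where
      open Admissible adm
      open Shape shape

  present⇔ : ∀ e t l → T (present e t l) ⇔ (blockLength e (toℕ l) + toℕ t ≤ w)
  present⇔ false t l = mk⇔
    (λ p → ≤-pred (m≤o∸n⇒m+n≤o (suc (toℕ l)) (<⇒≤ (toℕ<n t)) (≤ᵇ⇒≤ _ _ p)))
    (λ fits → ≤⇒≤ᵇ (m+n≤o⇒m≤o∸n (suc (toℕ l)) (s≤s fits)))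
  present⇔ true t l = mk⇔
    (λ p → ≤-pred (subst (_≤ k) (+-suc (suc (toℕ l)) (toℕ t))
                     (m≤o∸n⇒m+n≤o (suc (toℕ l)) (toℕ<n t) (≤ᵇ⇒≤ _ _ p))))
    (λ fits → ≤⇒≤ᵇ (m+n≤o⇒m≤o∸n (suc (toℕ l)) {suc (toℕ t)}
                     (subst (_≤ k) (sym (+-suc (suc (toℕ l)) (toℕ t))) (s≤s fits))))

  extend-shape : ∀ a e l {b} → J ≤ a → Shape (2 * a) b → blockLength e l + mult (2 * a) b ≤ w →
                 Shape (evenTop a) (extend e a l b)
  extend-shape a e l {b} J≤a sh fits = record
    { decreasing    = decreasing-extend e a l below decreasing
    ; noRepeatedOdd = noRepeatedOdd-extend e a l below noRepeatedOdd
    ; window        = window-prepend w a (topBlock e a l) b (topBlock-top e a l) decreasing below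
                        (subst (λ m → m + mult (2 * a) b ≤ w) (sym (length-topBlock e a l)) fits) window
    ; above         = AllP.++⁺ (All.map (λ top → ≤-<-trans (*-monoʳ-≤ 2 J≤a) (top-above {a} top)) (topBlock-top e a l))
                               above
    ; below         = AllP.++⁺ (All.map (top-≤ {a}) (topBlock-top e a l)) (All.map (λ y≤ → m≤n⇒m≤1+n (m≤n⇒m≤1+n y≤)) below) }
    where open Shape sh

  extend-shape⁻ : ∀ a e l {b} → All (_≤ 2 * a) b → Shape (evenTop a) (extend e a l b) →
                  Shape (2 * a) b × blockLength e l + mult (2 * a) b ≤ w
  extend-shape⁻ a e l {b} b≤ sh =
    record { decreasing = rest-decreasing ; noRepeatedOdd = noRepeatedOdd-++⁻ʳ P noRepeatedOdd
           ; window = window-++⁻ʳ w P window ; above = AllP.++⁻ʳ P above ; below = b≤ } ,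
    subst (λ m → m + mult (2 * a) b ≤ w) (length-topBlock e a l)
      (window-prepend⁻ w a P b (topBlock-top e a l) rest-decreasing b≤ window)
    where
    open Shape sh
    P : List ℕ
    P = topBlock e a l
    rest-decreasing : Decreasing b
    rest-decreasing = decreasing-++⁻ʳ P decreasing

  admissible-split : ∀ a l {b} → Admissible (evenTop a) l b →
    Σ Bool λ e → Σ (List ℕ) λ b′ → (b ≡ extend e a l b′) × Shape (2 * a) b′ × (blockLength e l + mult (2 * a) b′ ≤ w)
  admissible-split a l {b} adm with decompose a b (Shape.decreasing (Admissible.shape adm))
                                      (Shape.below (Admissible.shape adm)) (Shape.noRepeatedOdd (Admissible.shape adm))
  ... | e , b′ , b≡ , b′≤ = e , b′ , b≡′ , extend-shape⁻ a e l b′≤ (subst (Shape (evenTop a)) b≡′ (Admissible.shape adm))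
    where
    b≡′ : b ≡ extend e a l b′
    b≡′ = trans b≡ (cong (λ m → extend e a m b′) (Admissible.topMult adm))

  -- Condition (5) only sees the top block of level J.
  low-top : ∀ {x} → TopValue J x → T (low x)
  low-top (inj₁ refl) = Equivalence.from T-∨ (inj₂ (≡⇒≡ᵇ _ _ (sym (+-comm (2 * J) 2))))
  low-top (inj₂ refl) = Equivalence.from T-∨ (inj₁ (≡⇒≡ᵇ _ _ (sym (+-comm (2 * J) 1))))

  not-low : ∀ {x} → 2 * J + 2 < x → ¬ T (low x)
  not-low {x} x> lx with Equivalence.to T-∨ lx
  ... | inj₁ x≡ = <⇒≱ x> (≤-trans (≤-reflexive (≡ᵇ⇒≡ x _ x≡)) (+-monoʳ-≤ (2 * J) (n≤1+n 1)))
  ... | inj₂ x≡ = <⇒≱ x> (≤-reflexive (≡ᵇ⇒≡ x _ x≡))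

  lowCount-level1 : ∀ e l → countIf low (extend e J l []) ≡ blockLength e l
  lowCount-level1 e l = begin
    countIf low (topBlock e J l ++ [])  ≡⟨ countIf-++ low (topBlock e J l) [] ⟩
    countIf low (topBlock e J l) + 0    ≡⟨ +-identityʳ _ ⟩
    countIf low (topBlock e J l)        ≡⟨ countIf-all low _ (All.map low-top (topBlock-top e J l)) ⟩
    length (topBlock e J l)             ≡⟨ length-topBlock e J l ⟩
    blockLength e l                     ∎
    where open ≡-Reasoning

  lowCount-higher : ∀ a e l b → J < a → countIf low (extend e a l b) ≡ countIf low b
  lowCount-higher a e l b J<a = trans (countIf-++ low (topBlock e a l) b)
    (cong (_+ countIf low b) (countIf-none low _ (All.map (λ top → not-low (≤-<-trans 2J+2≤2a (top-above {a} top)))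
                                                          (topBlock-top e a l))))
    where
    2J+2≤2a : 2 * J + 2 ≤ 2 * a
    2J+2≤2a = subst (_≤ 2 * a) (trans (*-suc 2 J) (+-comm 2 (2 * J))) (*-monoʳ-≤ 2 J<a)

  rowList-zero⁻ : ∀ t {b} → b ∈ rowList 0 t → b ≡ [] × i ≡ t
  rowList-zero⁻ t b∈ with i ≟ᶠ t
  rowList-zero⁻ t (here refl) | yes i≡t = refl , i≡t
  rowList-zero⁻ t ()          | no  _

  []∈rowList-zero : [] ∈ rowList 0 i
  []∈rowList-zero with i ≟ᶠ i
  ... | yes _   = here refl
  ... | no  i≢i = ⊥-elim (i≢i refl)

  record Extension (n : ℕ) (t l : Fin k) (e : Bool) (b : List ℕ) : Set where
    constructor extension
    field
      rest    : List ℕ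
      allowed : T (present e t l)
      lower   : rest ∈ rowList n t
      shape   : b ≡ extend e (n + J) (toℕ l) rest

  ∈-extensions : ∀ e n t l {b} → b ∈ extensions e n t l ⇔ Extension n t l e b
  ∈-extensions e n t l = mk⇔ to from
    where
    to : ∀ {b} → b ∈ extensions e n t l → Extension n t l e b
    to b∈ with Equivalence.to (∈-if (present e t l)) b∈
    ... | ok , b∈map with ∈-map⁻ (extend e (n + J) (toℕ l)) b∈map
    ...   | b′ , b′∈ , b≡ = extension b′ ok b′∈ b≡
    from : ∀ {b} → Extension n t l e b → b ∈ extensions e n t l
    from (extension b′ ok b′∈ refl) =
      Equivalence.from (∈-if (present e t l)) (ok , ∈-map⁺ (extend e (n + J) (toℕ l)) b′∈)

  ∈-piece : ∀ n t l {b} → b ∈ piece n t l ⇔ Σ Bool (λ e → Extension n t l e b)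
  ∈-piece n t l = mk⇔ to from
    where
    to : ∀ {b} → b ∈ piece n t l → Σ Bool (λ e → Extension n t l e b)
    to b∈ with ∈-++⁻ (extensions false n t l) b∈
    ... | inj₁ b∈₀ = false , Equivalence.to (∈-extensions false n t l) b∈₀
    ... | inj₂ b∈₁ = true  , Equivalence.to (∈-extensions true n t l) b∈₁
    from : ∀ {b} → Σ Bool (λ e → Extension n t l e b) → b ∈ piece n t l
    from (false , ext) = ∈-++⁺ˡ (Equivalence.from (∈-extensions false n t l) ext)
    from (true  , ext) = ∈-++⁺ʳ (extensions false n t l) (Equivalence.from (∈-extensions true n t l) ext)

  ∈-rowList-suc : ∀ n l {b} → b ∈ rowList (suc n) l ⇔ Σ (Fin k) (λ t → Σ Bool (λ e → Extension n t l e b))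
  ∈-rowList-suc n l = mk⇔
    (λ b∈ → let t , b∈ₜ = Equivalence.to (∈-concatFin (λ t → piece n t l)) b∈ in t , Equivalence.to (∈-piece n t l) b∈ₜ)
    (λ (t , ext) → Equivalence.from (∈-concatFin (λ t → piece n t l)) (t , Equivalence.from (∈-piece n t l) ext))

  emptyShape : Shape (2 * J) []
  emptyShape = record { decreasing = [] ; noRepeatedOdd = tt ; window = tt ; above = [] ; below = [] }

  -- nothing lies strictly between 2J and 2J + 1
  shape-empty : ∀ {b} → Shape (2 * J) b → b ≡ []
  shape-empty {[]}    _  = refl
  shape-empty {x ∷ _} sh with Shape.above sh | Shape.below sh
  ... | 2J<x ∷ _ | x≤2J ∷ _ = ⊥-elim (<⇒≱ 2J<x x≤2J)

  -- At level one the role of the lower run of 2a's is played by the row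
  -- index i, through condition (5).
  rowList-one⇒ : ∀ l {b} → b ∈ rowList 1 l → Admissible (evenTop J) (toℕ l) b
  rowList-one⇒ l b∈ with Equivalence.to (∈-rowList-suc 0 l) b∈
  ... | t , e , extension b′ ok b′∈ refl with rowList-zero⁻ t b′∈
  ... | refl , refl = record
    { shape   = extend-shape J e (toℕ l) ≤-refl emptyShape
                  (subst (_≤ w) (sym (+-identityʳ _)) (m+n≤o⇒m≤o _ fits))
    ; fewLow  = subst (_≤ w ∸ toℕ i) (sym (lowCount-level1 e (toℕ l))) (m+n≤o⇒m≤o∸n _ fits)
    ; topMult = mult-extend e J (toℕ l) [] }
    where
    fits : blockLength e (toℕ l) + toℕ i ≤ w
    fits = Equivalence.to (present⇔ e i l) ok

  rowList-one⇐ : ∀ l {b} → Admissible (evenTop J) (toℕ l) b → b ∈ rowList 1 l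
  rowList-one⇐ l adm with admissible-split J (toℕ l) adm
  ... | e , b′ , refl , sh , _ with shape-empty sh
  ... | refl = Equivalence.from (∈-rowList-suc 0 l) (i , e , extension [] ok []∈rowList-zero refl)
    where
    ok : T (present e i l)
    ok = Equivalence.from (present⇔ e i l) (m≤o∸n⇒m+n≤o _ (≤-pred (toℕ<n i))
           (subst (_≤ w ∸ toℕ i) (lowCount-level1 e (toℕ l)) (Admissible.fewLow adm)))

  admissible-evenTop : ∀ a {c b} → Admissible (evenTop a) c b ≡ Admissible (2 * suc a) c b
  admissible-evenTop a {c} {b} = cong (λ top → Admissible top c b) (evenTop≡2*suc a)

  rowList-step⇒ : ∀ n → (∀ t {b} → b ∈ rowList (suc n) t → Admissible (evenTop (n + J)) (toℕ t) b) →
                  ∀ l {b} → b ∈ rowList (suc (suc n)) l → Admissible (evenTop (suc n + J)) (toℕ l) b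
  rowList-step⇒ n lowerLevel l b∈ with Equivalence.to (∈-rowList-suc (suc n) l) b∈
  ... | t , e , extension b′ ok b′∈ refl = record
    { shape   = extend-shape a e (toℕ l) (m≤n+m J (suc n)) (Admissible.shape lower)
                  (subst (λ m → blockLength e (toℕ l) + m ≤ w) (sym (Admissible.topMult lower))
                     (Equivalence.to (present⇔ e t l) ok))
    ; fewLow  = subst (_≤ w ∸ toℕ i) (sym (lowCount-higher a e (toℕ l) b′ (s≤s (m≤n+m J n))))
                  (Admissible.fewLow lower)
    ; topMult = mult-extend e a (toℕ l) (Shape.below (Admissible.shape lower)) }
    where
    a : ℕ
    a = suc n + J
    lower : Admissible (2 * a) (toℕ t) b′
    lower = subst id (admissible-evenTop (n + J)) (lowerLevel t b′∈)

  rowList-step⇐ : ∀ n → (∀ t {b} → Admissible (evenTop (n + J)) (toℕ t) b → b ∈ rowList (suc n) t) →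
                  ∀ l {b} → Admissible (evenTop (suc n + J)) (toℕ l) b → b ∈ rowList (suc (suc n)) l
  rowList-step⇐ n lowerLevel l adm with admissible-split (suc n + J) (toℕ l) adm
  ... | e , b′ , refl , sh , fits =
    Equivalence.from (∈-rowList-suc (suc n) l) (t , e , extension b′ ok (lowerLevel t lower) refl)
    where
    a : ℕ
    a = suc n + J
    -- the run of 2a's in b′ determines the column
    run<k : mult (2 * a) b′ < k
    run<k = s≤s (m+n≤o⇒n≤o _ fits)
    t : Fin k
    t = fromℕ< run<k
    ok : T (present e t l)
    ok = Equivalence.from (present⇔ e t l)
           (subst (λ m → blockLength e (toℕ l) + m ≤ w) (sym (toℕ-fromℕ< run<k)) fits)
    lower : Admissible (evenTop (n + J)) (toℕ t) b′
    lower = subst id (sym (admissible-evenTop (n + J))) (record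
      { shape   = sh
      ; fewLow  = ≤-trans (countIf-++⁻ʳ low (topBlock e a (toℕ l)) b′) (Admissible.fewLow adm)
      ; topMult = sym (toℕ-fromℕ< run<k) })

  rowList-admissible : ∀ n l b → b ∈ rowList (suc n) l ⇔ Admissible (evenTop (n + J)) (toℕ l) b
  rowList-admissible zero    l b = mk⇔ (rowList-one⇒ l) (rowList-one⇐ l)
  rowList-admissible (suc n) l b = mk⇔
    (rowList-step⇒ n (λ t {b′} → Equivalence.to (rowList-admissible n t b′)) l)
    (rowList-step⇐ n (λ t {b′} → Equivalence.from (rowList-admissible n t b′)) l)

  rowList-valid : ∀ n l b → b ∈ rowList (suc n) l ⇔ Valid k J (suc n + J) i l b
  rowList-valid n l b = mk⇔
    (λ b∈ → Equivalence.from (valid⇔admissible (suc n + J) l b)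
              (subst id (admissible-evenTop (n + J)) (Equivalence.to (rowList-admissible n l b) b∈)))
    (λ v → Equivalence.from (rowList-admissible n l b)
              (subst id (sym (admissible-evenTop (n + J))) (Equivalence.to (valid⇔admissible (suc n + J) l b) v)))

  -- No repetitions: a partition of rowList determines its column and, by
  -- extend-injective, the top block and the lower partition it came from.

  rowList-bounded : ∀ n t {b} → b ∈ rowList n t → All (_≤ 2 * (n + J)) b
  rowList-bounded zero    t b∈ with rowList-zero⁻ t b∈
  ... | refl , _ = []
  rowList-bounded (suc n) t {b} b∈ = subst (λ top → All (_≤ top) b) (evenTop≡2*suc (n + J))
    (Shape.below (Admissible.shape (Equivalence.to (rowList-admissible n t b) b∈)))

  rowList-column : ∀ n t t′ {b} → b ∈ rowList n t → b ∈ rowList n t′ → t ≡ t′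
  rowList-column zero    t t′ b∈ b∈′ = trans (sym (proj₂ (rowList-zero⁻ t b∈))) (proj₂ (rowList-zero⁻ t′ b∈′))
  rowList-column (suc n) t t′ {b} b∈ b∈′ = toℕ-injective (trans (sym (count t b∈)) (count t′ b∈′))
    where
    count : ∀ t → b ∈ rowList (suc n) t → mult (evenTop (n + J)) b ≡ toℕ t
    count t b∈ = Admissible.topMult (Equivalence.to (rowList-admissible n t b) b∈)

  extension-unique : ∀ n t t′ l e e′ {b} → Extension n t l e b → Extension n t′ l e′ b → e ≡ e′ × t ≡ t′
  extension-unique n t t′ l e e′ (extension b₁ _ b₁∈ refl) (extension b₂ _ b₂∈ b≡)
    with extend-injective (n + J) e e′ (toℕ l) (rowList-bounded n t b₁∈) (rowList-bounded n t′ b₂∈) b≡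
  ... | e≡e′ , refl = e≡e′ , rowList-column n t t′ b₁∈ b₂∈

  rowList-unique : ∀ n t → Unique (rowList n t)
  rowList-unique zero    t with ⌊ i ≟ᶠ t ⌋
  ... | true  = [] ∷ []
  ... | false = []
  rowList-unique (suc n) l = unique-concatFin (λ t → piece n t l) piece-unique columns-apart
    where
    columns-apart : ∀ t t′ {b} → b ∈ piece n t l → b ∈ piece n t′ l → t ≡ t′
    columns-apart t t′ b∈ b∈′ with Equivalence.to (∈-piece n t l) b∈ | Equivalence.to (∈-piece n t′ l) b∈′
    ... | e , ext | e′ , ext′ = proj₂ (extension-unique n t t′ l e e′ ext ext′)
    piece-unique : ∀ t → Unique (piece n t l)
    piece-unique t = Unique.++⁺ (kind-unique false) (kind-unique true) kinds-apart
      where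
      kind-unique : ∀ e → Unique (extensions e n t l)
      kind-unique e = unique-if (present e t l)
        (Unique.map⁺ (++-cancelˡ (topBlock e (n + J) (toℕ l)) _ _) (rowList-unique n t))
      kinds-apart : ∀ {b} → ¬ (b ∈ extensions false n t l × b ∈ extensions true n t l)
      kinds-apart (b∈₀ , b∈₁) with extension-unique n t t l false true
                                     (Equivalence.to (∈-extensions false n t l) b∈₀)
                                     (Equivalence.to (∈-extensions true n t l) b∈₁)
      ... | () , _

levelOf : ∀ J j → J < j → Σ ℕ λ n → suc n + J ≡ j
levelOf J (suc j) (s≤s J≤j) = j ∸ J , cong suc (m∸n+n≡m J≤j)

proposition6p1 : (k : ℕ) → 2 ≤ k → (J j : ℕ) → J < j → (i l : Fin k) →
    ∃ λ (L : List (List ℕ)) →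
      Unique L × (∀ b → (b ∈ L) ⇔ Valid k J j i l b) ×
      (∀ n → coeff (hMat k J j i l) n ≡ coeff (genSum L) n)
proposition6p1 zero    _ J j J<j () l
proposition6p1 (suc w) _ J j J<j i l with levelOf J j J<j
... | n , refl = rowList (suc n) l , rowList-unique (suc n) l , rowList-valid n l , rowList-genSum (suc n) l
  where open RowExpansion w J i
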